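{- Let $d\ge 2$, let $\mathcal{C}$ be a clutter on vertex set $V$, and let $v$ be a simplicial vertex of $\mathcal{C}$ such that $\mathcal{C}\setminus v$ has at least one $d$-non-circuit. Then $v$ is a shedding vertex of the Alexander dual (over $V$) of $I(c_d(\mathcal{C}))$.
   Context: A clutter on finite vertex set $V$ is a set of subsets (circuits) of $V$, none properly containing another. $I(\mathcal{D})$ is the simplicial complex on $V$ of subsets containing no circuit of $\mathcal{D}$. $c_d(\mathcal{C})$ is the clutter on $V$ whose circuits are the $d$-subsets of $V$ that are not circuits of $\mathcal{C}$; these are the $d$-non-circuits of $\mathcal{C}$ (so a $d$-non-circuit of $\mathcal{C}\setminus v$ is a $d$-subset of $V\setminus\{v\}$ that is not a circuit of $\mathcal{C}$). $\mathcal{C}\setminus v$ is the clutter on $V\setminus\{v\}$ with the circuits not containing $v$. A vertex $v$ is simplicial if for every two circuits $e_1,e_2$ containing $v$ there is a circuit $e_3\subseteq(e_1\cup e_2)\setminus\{v\}$. The Alexander dual over $V$ of a complex $\Delta$ on $V$ is the complex on $V$ whose facets are the sets $V\setminus e$ for $e$ a minimal non-face of $\Delta$. A vertex $v$ of a complex $\Delta$ is a shedding vertex if every face $\tau$ containing $v$ admits $w\in V\setminus\tau$ with $(\tau\cup\{w\})\setminus\{v\}\in\Delta$ (equivalently, no facet of $\operatorname{link}_\Delta v$ is a facet of $\Delta\setminus v$). -}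

module Defs where

open import Data.Nat using (ℕ)
open import Data.Bool using (Bool; true)
open import Data.Fin using (Fin)
open import Data.Fin.Subset using (Subset; _∈_; _∉_; _⊆_; _⊂_; _∪_; _-_; ∁; ∣_∣; ⁅_⁆)
open import Data.Product using (Σ; _×_; ∃)
open import Relation.Nullary using (¬_)
open import Relation.Binary.PropositionalEquality using (_≡_; _≢_)

-- The vertex set V is Fin n.  A clutter on V is given by the
-- (decidable, V being finite) characteristic function of its set of circuits.
SetFamily : ℕ → Set
SetFamily n = Subset n → Bool

Circuit : ∀ {n} → SetFamily n → Subset n → Set
Circuit C e = C e ≡ true

IsClutter : ∀ {n} → SetFamily n → Set
IsClutter {n} C = (e f : Subset n) → Circuit C e → Circuit C f → ¬ (e ⊂ f)

Complex : ℕ → Set₁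
Complex n = Subset n → Set

Ind : ∀ {n} → (Subset n → Set) → Complex n
Ind {n} D σ = ¬ (Σ (Subset n) λ e → D e × e ⊆ σ)

cd-Circuit : ∀ {n} → ℕ → SetFamily n → Subset n → Set
cd-Circuit d C e = ∣ e ∣ ≡ d × ¬ Circuit C e

Ind-cd : ∀ {n} → ℕ → SetFamily n → Complex n
Ind-cd d C = Ind (cd-Circuit d C)

NonCircuitDel : ∀ {n} → ℕ → SetFamily n → Fin n → Subset n → Set
NonCircuitDel d C v e = ∣ e ∣ ≡ d × v ∉ e × ¬ Circuit C e

IsSimplicial : ∀ {n} → SetFamily n → Fin n → Set
IsSimplicial {n} C v =
  (e₁ e₂ : Subset n) → Circuit C e₁ → Circuit C e₂ → e₁ ≢ e₂ →
  v ∈ e₁ → v ∈ e₂ →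
  Σ (Subset n) λ e₃ → Circuit C e₃ × e₃ ⊆ ((e₁ ∪ e₂) - v)

MinNonFace : ∀ {n} → Complex n → Subset n → Set
MinNonFace {n} Δ e = ¬ Δ e × ((f : Subset n) → f ⊂ e → Δ f)

-- Alexander dual over V: the complex whose facets are V \ e, e a minimal non-face
AlexDual : ∀ {n} → Complex n → Complex n
AlexDual {n} Δ σ = Σ (Subset n) λ e → MinNonFace Δ e × σ ⊆ ∁ e

IsShedding : ∀ {n} → Complex n → Fin n → Set
IsShedding {n} Δ v =
  (τ : Subset n) → Δ τ → v ∈ τ →
  Σ (Fin n) λ w → w ∉ τ × Δ ((τ ∪ ⁅ w ⁆) - v)

module Submission where

-- Write Δ = I(c_d(C)).  Since all circuits of c_d(C) have the
-- same size d, they form an antichain, so the minimal non-faces of Δ are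
-- exactly the d-non-circuits of C; hence a face τ of the Alexander dual is a
-- set disjoint from some d-non-circuit e.  If v ∈ τ then v ∉ e, and for
-- w ∈ e we consider the exchange  e[w↦v] = (e - w) ∪ {v}, again a d-set.
-- Whenever e[w↦v] is not a circuit of C, it is a minimal non-face of Δ
-- disjoint from (τ ∪ {w}) - v, and w ∉ τ, so w witnesses shedding.
-- Such a w exists: if every exchange were a circuit, pick w₁ ≠ w₂ in e
-- (d ≥ 2); simpliciality of v yields a circuit e₃ ⊆ (e[w₁↦v] ∪ e[w₂↦v]) - v
-- ⊆ e.  As e is no circuit, e₃ misses some x ∈ e, and then e₃ ⊂ e[x↦v]
-- properly (v ∉ e₃), contradicting that C is a clutter.

open import Defs
open import Data.Nat using (ℕ; suc; _≤_; _<_; s≤s⁻¹)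
open import Data.Nat.Properties using (<-irrefl; ≤-trans; n≤1+n; _≟_)
open import Data.Bool using (true)
import Data.Bool.Properties as Bool
open import Data.Fin using (Fin; zero; suc)
open import Data.Fin.Properties using (any?)
open import Data.Fin.Subset
  using (Subset; _∈_; _∉_; _⊆_; _⊂_; _∪_; _-_; ∁; ∣_∣; ⁅_⁆; inside; outside; Nonempty)
open import Data.Fin.Subset.Properties
open import Data.Vec using (_∷_; here; there)
open import Data.Product using (Σ; ∃; _×_; _,_; proj₁; proj₂)
open import Function using (_∘_)
open import Data.Sum using (_⊎_; inj₁; inj₂)
open import Data.Empty using (⊥-elim) renaming (⊥ to False)
open import Relation.Nullary using (¬_; Dec; yes; no; contradiction)
open import Relation.Nullary.Decidable using (_×-dec_; ¬?)
open import Relation.Unary using (Pred; Decidable)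
open import Relation.Binary.PropositionalEquality
  using (_≡_; _≢_; refl; sym; trans; cong; subst)

x∉p-x : ∀ {n} (x : Fin n) (p : Subset n) → x ∉ p - x
x∉p-x zero    (s ∷ p) ()
x∉p-x (suc x) (s ∷ p) (there m) = x∉p-x x p m

x∈p-y⁻ : ∀ {n} {x y : Fin n} {p : Subset n} → x ∈ p - y → x ∈ p × x ≢ y
x∈p-y⁻ {x = x} {y} {p} m = p─q⊆p p ⁅ y ⁆ m , λ { refl → x∉p-x x p m }

∣p-x∣ : ∀ {n} (x : Fin n) (p : Subset n) → x ∈ p → suc ∣ p - x ∣ ≡ ∣ p ∣
∣p-x∣ zero    (inside ∷ p)  here      = cong suc (cong ∣_∣ (p─⊥≡p p))
∣p-x∣ (suc x) (inside ∷ p)  (there m) = cong suc (∣p-x∣ x p m)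
∣p-x∣ (suc x) (outside ∷ p) (there m) = ∣p-x∣ x p m

∣p∪⁅x⁆∣ : ∀ {n} (x : Fin n) (p : Subset n) → x ∉ p → ∣ p ∪ ⁅ x ⁆ ∣ ≡ suc ∣ p ∣
∣p∪⁅x⁆∣ zero    (inside ∷ p)  x∉ = contradiction here x∉
∣p∪⁅x⁆∣ zero    (outside ∷ p) x∉ = cong suc (cong ∣_∣ (∪-identityʳ p))
∣p∪⁅x⁆∣ (suc x) (inside ∷ p)  x∉ = cong suc (∣p∪⁅x⁆∣ x p (λ m → x∉ (there m)))
∣p∪⁅x⁆∣ (suc x) (outside ∷ p) x∉ = ∣p∪⁅x⁆∣ x p (λ m → x∉ (there m))

positive⇒nonempty : ∀ {n} (p : Subset n) → 0 < ∣ p ∣ → Nonempty p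
positive⇒nonempty {n} p 0<∣p∣ with nonempty? p
... | yes ne = ne
... | no  ¬ne =
  ⊥-elim (<-irrefl (sym (trans (cong ∣_∣ (Empty-unique ¬ne)) (∣⊥∣≡0 n))) 0<∣p∣)

two-elements : ∀ {n} (p : Subset n) → 2 ≤ ∣ p ∣ →
  ∃ λ a → ∃ λ b → a ∈ p × b ∈ p × a ≢ b
two-elements p 2≤∣p∣ =
  let (a , a∈p) = positive⇒nonempty p (≤-trans (n≤1+n 1) 2≤∣p∣)
      2≤1+∣p-a∣ = subst (2 ≤_) (sym (∣p-x∣ a p a∈p)) 2≤∣p∣
      (b , b∈p-a) = positive⇒nonempty (p - a) (s≤s⁻¹ 2≤1+∣p-a∣)
      (b∈p , b≢a) = x∈p-y⁻ b∈p-a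
  in a , b , a∈p , b∈p , λ a≡b → b≢a (sym a≡b)

⊈-witness : ∀ {n} (p q : Subset n) → ¬ p ⊆ q → ∃ λ x → x ∈ p × x ∉ q
⊈-witness p q p⊈q with any? (λ x → x ∈? p ×-dec ¬? (x ∈? q))
... | yes w = w
... | no none = ⊥-elim (p⊈q λ {x} x∈p → case-∈ x x∈p)
  where
  case-∈ : ∀ x → x ∈ p → x ∈ q
  case-∈ x x∈p with x ∈? q
  ... | yes x∈q = x∈q
  ... | no  x∉q = ⊥-elim (none (x , x∈p , x∉q))

Antichain : ∀ {n} → Pred (Subset n) _ → Set
Antichain {n} D = (f g : Subset n) → D f → D g → ¬ f ⊂ g

minNonFace⇒member : ∀ {n} {D : Pred (Subset n) _} → Decidable D →
  (e : Subset n) → MinNonFace (Ind D) e → D e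
minNonFace⇒member {D = D} D? e (nonface , minimal)
  with anySubset? (λ g → D? g ×-dec g ⊆? e)
... | no ¬g = ⊥-elim (nonface λ (g , Dg , g⊆e) → ¬g (g , Dg , g⊆e))
... | yes (g , Dg , g⊆e) with e ⊆? g
...   | yes e⊆g = subst D (⊆-antisym g⊆e e⊆g) Dg
...   | no  e⊈g =
  let (x , x∈e , x∉g) = ⊈-witness e g e⊈g
  in ⊥-elim (minimal g (g⊆e , x , x∈e , x∉g) (g , Dg , ⊆-refl))

member⇒minNonFace : ∀ {n} {D : Pred (Subset n) _} → Antichain D →
  (e : Subset n) → D e → MinNonFace (Ind D) e
member⇒minNonFace antichain e De =
  (λ face → face (e , De , ⊆-refl)) ,
  λ f f⊂e (g , Dg , g⊆f) → antichain g e Dg De (⊆-⊂-trans g⊆f f⊂e)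

-- The circuits of c_d(C) all have size d, so they form an antichain ...
cd-antichain : ∀ {n} d (C : SetFamily n) → Antichain (cd-Circuit d C)
cd-antichain d C f g (∣f∣≡d , _) (∣g∣≡d , _) f⊂g =
  <-irrefl (trans ∣f∣≡d (sym ∣g∣≡d)) (p⊂q⇒∣p∣<∣q∣ f⊂g)

circuit? : ∀ {n} (C : SetFamily n) (e : Subset n) → Dec (Circuit C e)
circuit? C e = C e Bool.≟ true

cd-circuit? : ∀ {n} d (C : SetFamily n) → Decidable (cd-Circuit d C)
cd-circuit? d C e = ∣ e ∣ ≟ d ×-dec ¬? (circuit? C e)

exchange : ∀ {n} → Subset n → Fin n → Fin n → Subset n
exchange e w v = (e - w) ∪ ⁅ v ⁆

v∈exchange : ∀ {n} (e : Subset n) w v → v ∈ exchange e w v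
v∈exchange e w v = x∈p∪q⁺ (inj₂ (x∈⁅x⁆ v))

exchange⁺ : ∀ {n} {e : Subset n} {x} w v → x ∈ e → x ≢ w → x ∈ exchange e w v
exchange⁺ w v x∈e x≢w = x∈p∪q⁺ (inj₁ (x∈p∧x≢y⇒x∈p-y x∈e x≢w))

exchange⁻ : ∀ {n} {e : Subset n} {x} w v → x ∈ exchange e w v →
  (x ∈ e × x ≢ w) ⊎ x ≡ v
exchange⁻ {e = e} w v m with x∈p∪q⁻ (e - w) ⁅ v ⁆ m
... | inj₁ x∈e-w = inj₁ (x∈p-y⁻ x∈e-w)
... | inj₂ x∈⁅v⁆ = inj₂ (x∈⁅y⁆⇒x≡y v x∈⁅v⁆)

exchange-v⊆e : ∀ {n} {e : Subset n} {x} w v → x ∈ exchange e w v → x ≢ v → x ∈ e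
exchange-v⊆e w v m x≢v with exchange⁻ w v m
... | inj₁ (x∈e , _) = x∈e
... | inj₂ x≡v       = contradiction x≡v x≢v

∣exchange∣ : ∀ {n} (e : Subset n) w v → w ∈ e → v ∉ e → ∣ exchange e w v ∣ ≡ ∣ e ∣
∣exchange∣ e w v w∈e v∉e =
  trans (∣p∪⁅x⁆∣ v (e - w) (λ m → v∉e (proj₁ (x∈p-y⁻ m)))) (∣p-x∣ w e w∈e)

exchanges-v⊆e : ∀ {n} {e : Subset n} w₁ w₂ v →
  (exchange e w₁ v ∪ exchange e w₂ v) - v ⊆ e
exchanges-v⊆e {e = e} w₁ w₂ v m with x∈p-y⁻ m
... | x∈∪ , x≢v with x∈p∪q⁻ (exchange e w₁ v) (exchange e w₂ v) x∈∪
...   | inj₁ x∈e₁ = exchange-v⊆e w₁ v x∈e₁ x≢v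
...   | inj₂ x∈e₂ = exchange-v⊆e w₂ v x∈e₂ x≢v

exchange-injective : ∀ {n} {e : Subset n} {w₁ w₂} v → v ∉ e →
  w₁ ∈ e → w₂ ∈ e → w₁ ≢ w₂ → exchange e w₁ v ≢ exchange e w₂ v
exchange-injective {e = e} {w₁} {w₂} v v∉e w₁∈e w₂∈e w₁≢w₂ eq =
  w₁∉ (subst (w₁ ∈_) (sym eq) (exchange⁺ w₂ v w₁∈e w₁≢w₂))
  where
  w₁∉ : w₁ ∉ exchange e w₁ v
  w₁∉ m with exchange⁻ w₁ v m
  ... | inj₁ (_ , w₁≢w₁) = w₁≢w₁ refl
  ... | inj₂ w₁≡v        = v∉e (subst (_∈ e) w₁≡v w₁∈e)

shift-avoids-exchange : ∀ {n} {τ e : Subset n} {w} v → τ ⊆ ∁ e →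
  (τ ∪ ⁅ w ⁆) - v ⊆ ∁ (exchange e w v)
shift-avoids-exchange {τ = τ} {e} {w} v τ⊆∁e {x} m =
  x∉p⇒x∈∁p λ x∈exch → avoid (exchange⁻ w v x∈exch)
  where
  x∈τ∪w = proj₁ (x∈p-y⁻ m)
  x≢v   = proj₂ (x∈p-y⁻ m)
  avoid : ¬ ((x ∈ e × x ≢ w) ⊎ x ≡ v)
  avoid (inj₂ x≡v) = x≢v x≡v
  avoid (inj₁ (x∈e , x≢w)) with x∈p∪q⁻ τ ⁅ w ⁆ x∈τ∪w
  ... | inj₁ x∈τ = x∈∁p⇒x∉p (τ⊆∁e x∈τ) x∈e
  ... | inj₂ x∈w = x≢w (x∈⁅y⁆⇒x≡y w x∈w)

module _ {n} (C : SetFamily n) (clutter : IsClutter C) (v : Fin n)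
         (e : Subset n) (v∉e : v ∉ e) (e-noncircuit : ¬ Circuit C e) where

  AllExchangesCircuits : Set
  AllExchangesCircuits = ∀ w → w ∈ e → Circuit C (exchange e w v)

  -- If all exchanges are circuits, no circuit avoiding v lies inside e:
  -- it would be e itself, or lie properly inside the exchange of an element
  -- of e it misses.
  no-circuit-inside : AllExchangesCircuits → (e₃ : Subset n) → Circuit C e₃ →
    e₃ ⊆ e → v ∉ e₃ → False
  no-circuit-inside all-circuits e₃ e₃-circuit e₃⊆e v∉e₃ with e ⊆? e₃
  ... | yes e⊆e₃ = e-noncircuit (subst (Circuit C) (⊆-antisym e₃⊆e e⊆e₃) e₃-circuit)
  ... | no  e⊈e₃ =
    let (x , x∈e , x∉e₃) = ⊈-witness e e₃ e⊈e₃
        e₃⊆exchange : e₃ ⊆ exchange e x v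
        e₃⊆exchange m = exchange⁺ x v (e₃⊆e m) λ { refl → x∉e₃ m }
    in clutter e₃ (exchange e x v) e₃-circuit (all-circuits x x∈e)
         (e₃⊆exchange , v , v∈exchange e x v , v∉e₃)

  -- Simpliciality of v applied to two distinct exchanges produces a circuit
  -- inside e avoiding v.
  simplicial-circuit-inside : IsSimplicial C v → 2 ≤ ∣ e ∣ → AllExchangesCircuits →
    Σ (Subset n) λ e₃ → Circuit C e₃ × e₃ ⊆ e × v ∉ e₃
  simplicial-circuit-inside simplicial 2≤∣e∣ all-circuits =
    let (w₁ , w₂ , w₁∈e , w₂∈e , w₁≢w₂) = two-elements e 2≤∣e∣
        (e₃ , e₃-circuit , e₃⊆) =
          simplicial (exchange e w₁ v) (exchange e w₂ v)
            (all-circuits w₁ w₁∈e) (all-circuits w₂ w₂∈e)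
            (exchange-injective v v∉e w₁∈e w₂∈e w₁≢w₂)
            (v∈exchange e w₁ v) (v∈exchange e w₂ v)
    in e₃ , e₃-circuit , exchanges-v⊆e w₁ w₂ v ∘ e₃⊆ ,
       λ v∈e₃ → proj₂ (x∈p-y⁻ (e₃⊆ v∈e₃)) refl

  noncircuit-exchange : IsSimplicial C v → 2 ≤ ∣ e ∣ →
    ∃ λ w → w ∈ e × ¬ Circuit C (exchange e w v)
  noncircuit-exchange simplicial 2≤∣e∣
    with any? (λ w → w ∈? e ×-dec ¬? (circuit? C (exchange e w v)))
  ... | yes found = found
  ... | no none =
    let (e₃ , e₃-circuit , e₃⊆e , v∉e₃) =
          simplicial-circuit-inside simplicial 2≤∣e∣ all-circuits
    in ⊥-elim (no-circuit-inside all-circuits e₃ e₃-circuit e₃⊆e v∉e₃)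
    where
    all-circuits : AllExchangesCircuits
    all-circuits w w∈e with circuit? C (exchange e w v)
    ... | yes c  = c
    ... | no  ¬c = ⊥-elim (none (w , w∈e , ¬c))

lemma6p8 : (n d : ℕ) → 2 ≤ d → (C : SetFamily n) → IsClutter C →
    (v : Fin n) → IsSimplicial C v →
    Σ (Subset n) (NonCircuitDel d C v) →
    IsShedding (AlexDual (Ind-cd d C)) v
lemma6p8 n d 2≤d C clutter v simplicial _ τ (e , e-minimal , τ⊆∁e) v∈τ =
  w , w∉τ , exchange e w v , exchange-minimal , shift-avoids-exchange v τ⊆∁e
  where
  e-cd : cd-Circuit d C e
  e-cd = minNonFace⇒member (cd-circuit? d C) e e-minimal
  v∉e : v ∉ e
  v∉e = x∈∁p⇒x∉p (τ⊆∁e v∈τ)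
  found : ∃ λ w → w ∈ e × ¬ Circuit C (exchange e w v)
  found = noncircuit-exchange C clutter v e v∉e (proj₂ e-cd) simplicial
            (subst (2 ≤_) (sym (proj₁ e-cd)) 2≤d)
  w : Fin n
  w = proj₁ found
  w∈e : w ∈ e
  w∈e = proj₁ (proj₂ found)
  w∉τ : w ∉ τ
  w∉τ w∈τ = x∈∁p⇒x∉p (τ⊆∁e w∈τ) w∈e
  exchange-minimal : MinNonFace (Ind-cd d C) (exchange e w v)
  exchange-minimal = member⇒minNonFace (cd-antichain d C) (exchange e w v)
    (trans (∣exchange∣ e w v w∈e v∉e) (proj₁ e-cd) , proj₂ (proj₂ found))
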